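{- The directed graph $\mathcal{T}(z)$ is a rooted infinite binary tree with root $z$. Its set of vertices is exactly the set of all special positive linear fractional transformations. Each special positive linear fractional transformation occurs exactly once as a vertex of $\mathcal{T}(z)$, that is, exactly once among all entries of all rows.
   Context: Let $\mathbb{N}_0=\{0,1,2,\dots\}$ and let $z$ be a variable. A positive linear fractional transformation is an expression $w=\frac{az+b}{cz+d}$ with $a,b,c,d\in\mathbb{N}_0$ and $ad-bc\neq0$, identified with its coefficient matrix. It is special if $ad-bc=1$. For such $w$, its left child is $\frac{w}{w+1}:=\frac{az+b}{(a+c)z+(b+d)}$ and its right child is $w+1:=\frac{(a+c)z+(b+d)}{cz+d}$. The rows of $\mathcal{T}(z)$ are defined recursively. Row $0$ is the one-term sequence $(z)$, where $z=\frac{1z+0}{0z+1}$. For $n\ge1$, row $n$ is $(w_{n,1},\dots,w_{n,2^n})$, with $w_{n,2i-1}=\frac{w_{n-1,i}}{w_{n-1,i}+1}$ and $w_{n,2i}=w_{n-1,i}+1$ for $i=1,\dots,2^{n-1}$. The graph $\mathcal{T}(z)$ has as vertices the entries of all rows, and has a directed edge from each vertex to each of its two children. A rooted infinite binary tree is a directed graph with the following three properties: - every vertex is the tail of exactly two edges; - there is a vertex $v^*$ (the root) that is the head of no edge, while every other vertex is the head of exactly one edge; - the underlying graph is connected. -}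

module Defs where

open import Data.Nat using (ℕ; zero; suc; _+_; _*_)
open import Data.List using (List; []; _∷_; length; lookup)
open import Data.Fin using (Fin)
open import Data.Product using (Σ; ∃; ∃!; _×_; _,_)
open import Data.Sum using (_⊎_)
open import Relation.Binary.PropositionalEquality using (_≡_; _≢_)
open import Relation.Nullary using (¬_)
open import Level using (Level; _⊔_) renaming (suc to lsuc)

-- A linear fractional transformation (az+b)/(cz+d) with a,b,c,d ∈ ℕ₀,
-- identified with its coefficient matrix (a b ; c d).
record Mat : Set where
  constructor mat
  field
    a b c d : ℕ

open Mat public

PositiveLFT : Mat → Set
PositiveLFT m = a m * d m ≢ b m * c m

Special : Mat → Set
Special m = a m * d m ≡ b m * c m + 1

-- the variable z = (1z+0)/(0z+1)
zM : Mat
zM = mat 1 0 0 1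

-- left child  w/(w+1) = (az+b)/((a+c)z+(b+d))
leftChild : Mat → Mat
leftChild (mat a b c d) = mat a b (a + c) (b + d)

-- right child  w+1 = ((a+c)z+(b+d))/(cz+d)
rightChild : Mat → Mat
rightChild (mat a b c d) = mat (a + c) (b + d) c d

expand : List Mat → List Mat
expand [] = []
expand (w ∷ ws) = leftChild w ∷ rightChild w ∷ expand ws

row : ℕ → List Mat
row zero = zM ∷ []
row (suc n) = expand (row n)

Position : Set
Position = Σ ℕ λ n → Fin (length (row n))

entry : Position → Mat
entry (n , i) = lookup (row n) i

-- Directed graphs (on a carrier type, with a vertex predicate and an
-- edge relation; there is at most one edge u → v).

record DiGraph {ℓ} (V : Set ℓ) : Set (lsuc ℓ) where
  field
    Vertex : V → Set ℓ
    Edge   : V → V → Set ℓ   -- Edge u v : edge with tail u and head v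
open DiGraph public

data UPath {ℓ} {V : Set ℓ} (G : DiGraph V) : V → V → Set ℓ where
  stay : ∀ {u} → Vertex G u → UPath G u u
  fwd  : ∀ {u v w} → Edge G u v → UPath G v w → UPath G u w
  bwd  : ∀ {u v w} → Edge G v u → UPath G v w → UPath G u w

IsRootedInfiniteBinaryTree : ∀ {ℓ} {V : Set ℓ} → DiGraph V → V → Set ℓ
IsRootedInfiniteBinaryTree G r =
    (∀ u → Vertex G u →
       Σ _ λ v₁ → Σ _ λ v₂ → v₁ ≢ v₂ × Edge G u v₁ × Edge G u v₂ ×
         (∀ v → Edge G u v → v ≡ v₁ ⊎ v ≡ v₂))
  ×
    (Vertex G r × (∀ u → ¬ Edge G u r))
  ×
    (∀ v → Vertex G v → v ≢ r → ∃! _≡_ (λ u → Edge G u v))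
  ×
    (∀ u v → Vertex G u → Vertex G v → UPath G u v)

IsVertexT : Mat → Set
IsVertexT m = ∃ λ (p : Position) → entry p ≡ m

𝒯 : DiGraph Mat
𝒯 = record
  { Vertex = IsVertexT
  ; Edge   = λ u v → IsVertexT u × (v ≡ leftChild u ⊎ v ≡ rightChild u)
  }

module Submission where

-- Both children of a matrix are special iff the matrix
--    is (the child's determinant equation is the parent's plus a common
--    summand); the children of special matrices are never z, never coincide
--    across sides, and each side determines the parent.
-- 2. Euclid's step.  A special matrix other than z is a child of a special
--    matrix: comparing the rows decides whether it is a left or a right child,
--    and subtracting the smaller row gives the parent, which is strictly
--    smaller.  By well-founded induction on size, every special matrix occurs.
-- 3. Rows.  Indices of row n+1 are exactly the child indices of row n; hence
--    every entry is special and, by the injectivity in 1, no matrix occurs at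
--    two positions.
-- 4. The tree axioms then follow: out-edges go to the two (distinct)
--    children, the parent of a non-root vertex is given by Euclid's step and
--    is unique by 1, and every vertex is linked to the root through its row
--    ancestry.

open import Defs
open import Data.Product using (_×_; ∃!)
open import Function.Bundles using (_⇔_)
open import Relation.Binary.PropositionalEquality using (_≡_)

open import Level using (0ℓ)
open import Data.Nat using (ℕ; zero; suc; _+_; _*_; _≤_; _<_; z≤n; s≤s)
open import Data.Nat.Properties
  using ( +-comm; *-comm; +-identityʳ; *-zeroʳ; +-cancelˡ-≡; +-cancelʳ-≡; +-cancelˡ-≤
        ; m≤m+n; m≤n+m; m<m+n; ≤-trans; <⇒≤; ≤-<-connex; *-mono-≤; n≤0⇒n≡0
        ; m+n≡0⇒m≡0; m+n≡0⇒n≡0; m*n≡1⇒m≡1; m*n≡1⇒n≡1; m≤n⇒∃[o]m+o≡n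
        ; 0≢1+n; m+1+n≢0; m+1+n≢m; 1+n≰n )
open import Data.Nat.Induction using (<-wellFounded)
open import Data.Nat.Tactic.RingSolver using (solve-∀)
open import Data.List using (List; _∷_; length; lookup)
open import Data.Fin using (Fin) renaming (zero to fzero; suc to fsuc)
open import Data.Product using (Σ; ∃; _,_; proj₁; proj₂)
open import Data.Sum using (_⊎_; inj₁; inj₂)
open import Data.Empty using (⊥-elim)
open import Relation.Nullary using (¬_)
open import Function.Bundles using (mk⇔; module Equivalence)
open import Induction.WellFounded using (module All)
open import Relation.Binary.Construct.On as On using ()
open import Relation.Binary.PropositionalEquality
  using (refl; sym; trans; cong; cong₂; subst; subst₂; _≢_)

cancel-common : ∀ {x y x′ y′} k → x ≡ k + x′ → y ≡ k + y′ → (x ≡ y) ⇔ (x′ ≡ y′)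
cancel-common k ex ey =
  mk⇔ (λ e → +-cancelˡ-≡ k _ _ (trans (sym ex) (trans e ey)))
      (λ e → trans ex (trans (cong (k +_) e) (sym ey)))

m+n≤m⇒n≡0 : ∀ m {n} → m + n ≤ m → n ≡ 0
m+n≤m⇒n≡0 m {n} le = n≤0⇒n≡0 (+-cancelˡ-≤ m n 0 (subst (m + n ≤_) (sym (+-identityʳ m)) le))

≤⇒∃+ˡ : ∀ {m n} → m ≤ n → ∃ λ k → k + m ≡ n
≤⇒∃+ˡ {m} m≤n with m≤n⇒∃[o]m+o≡n m≤n
... | k , e = k , trans (+-comm k m) e

data Side : Set where
  left right : Side

child : Side → Mat → Mat
child left  = leftChild
child right = rightChild

-- A child is special exactly when its parent is: its determinant equation
-- is the parent's with the summand ab (left) or cd (right) added on both sides.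
child-special⇔ : ∀ s m → Special (child s m) ⇔ Special m
child-special⇔ left (mat a b c d) =
  cancel-common (a * b) (leftDet a b d) (leftOff a b c)
  where
  leftDet : ∀ a b d → a * (b + d) ≡ a * b + a * d
  leftDet = solve-∀
  leftOff : ∀ a b c → b * (a + c) + 1 ≡ a * b + (b * c + 1)
  leftOff = solve-∀
child-special⇔ right (mat a b c d) =
  cancel-common (c * d) (rightDet a c d) (rightOff b c d)
  where
  rightDet : ∀ a c d → (a + c) * d ≡ c * d + a * d
  rightDet = solve-∀
  rightOff : ∀ b c d → (b + d) * c + 1 ≡ c * d + (b * c + 1)
  rightOff = solve-∀

child-special : ∀ s m → Special m → Special (child s m)
child-special s m = Equivalence.from (child-special⇔ s m)

parent-special : ∀ s m → Special (child s m) → Special m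
parent-special s m = Equivalence.to (child-special⇔ s m)

-- Neither child is z: z has a zero entry that no child can have.
child≢z : ∀ s m → child s m ≢ zM
child≢z left (mat a b c d) eq with cong Mat.a eq
... | refl with cong Mat.c eq
... | ()
child≢z right (mat a b c d) eq with cong Mat.c eq | cong Mat.d eq
... | refl | refl = m+1+n≢0 b (cong Mat.b eq)

-- A left child of a special matrix is never a right child: equality would
-- force the bottom row of the left child's parent to vanish.
left≢right : ∀ {u u′} → Special u → leftChild u ≢ rightChild u′
left≢right {mat a b c d} {mat a′ b′ _ _} sp eq with cong Mat.c eq | cong Mat.d eq
... | refl | refl with c≡0 | d≡0
  where
  c≡0 : c ≡ 0
  c≡0 = m+n≤m⇒n≡0 a (subst (a + c ≤_) (sym (cong Mat.a eq)) (m≤n+m (a + c) a′))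
  d≡0 : d ≡ 0
  d≡0 = m+n≤m⇒n≡0 b (subst (b + d ≤_) (sym (cong Mat.b eq)) (m≤n+m (b + d) b′))
... | refl | refl = 0≢1+n (trans (sym (*-zeroʳ a)) (trans sp (cong (_+ 1) (*-zeroʳ b))))

child-injective : ∀ s s′ {u u′} → Special u → Special u′ →
                  child s u ≡ child s′ u′ → s ≡ s′ × u ≡ u′
child-injective left left {mat a b c d} {mat a′ b′ c′ d′} _ _ eq
  with cong Mat.a eq | cong Mat.b eq
... | refl | refl =
  refl , cong₂ (mat a b) (+-cancelˡ-≡ a _ _ (cong Mat.c eq)) (+-cancelˡ-≡ b _ _ (cong Mat.d eq))
child-injective right right {mat a b c d} {mat a′ b′ c′ d′} _ _ eq
  with cong Mat.c eq | cong Mat.d eq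
... | refl | refl =
  refl , cong₂ (λ x y → mat x y c d) (+-cancelʳ-≡ c a a′ (cong Mat.a eq)) (+-cancelʳ-≡ d b b′ (cong Mat.b eq))
child-injective left  right sp _   eq = ⊥-elim (left≢right sp eq)
child-injective right left  _  sp′ eq = ⊥-elim (left≢right sp′ (sym eq))

-- Sum of the entries; it strictly decreases from a special child to its parent.
size : Mat → ℕ
size (mat a b c d) = a + b + c + d

special⇒0<a : ∀ m → Special m → 0 < a m
special⇒0<a (mat zero    b c d) sp = ⊥-elim (m+1+n≢0 (b * c) (sym sp))
special⇒0<a (mat (suc a) b c d) _  = s≤s z≤n

special⇒0<d : ∀ m → Special m → 0 < d m
special⇒0<d (mat a b c zero)    sp = ⊥-elim (m+1+n≢0 (b * c) (sym (trans (sym (*-zeroʳ a)) sp)))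
special⇒0<d (mat a b c (suc d)) _  = s≤s z≤n

-- A child adds a row of its parent to the other row, so it is strictly larger
-- than a special parent, whose rows are nonzero.
size-child : ∀ s m → Special m → size m < size (child s m)
size-child left m@(mat a b c d) sp =
  subst (size m <_) (grow a b c d) (m<m+n (size m) (≤-trans (special⇒0<a m sp) (m≤m+n a b)))
  where
  grow : ∀ a b c d → a + b + c + d + (a + b) ≡ a + b + (a + c) + (b + d)
  grow = solve-∀
size-child right m@(mat a b c d) sp =
  subst (size m <_) (grow a b c d) (m<m+n (size m) (≤-trans (special⇒0<d m sp) (m≤n+m d c)))
  where
  grow : ∀ a b c d → a + b + c + d + (c + d) ≡ (a + c) + (b + d) + c + d
  grow = solve-∀

data Origin (m : Mat) : Set where
  root    : m ≡ zM → Origin m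
  childOf : ∀ s p → Special p → m ≡ child s p → Origin m

-- A special matrix whose diagonal strictly dominates its off-diagonal is z:
-- (c + 1)(b + 1) ≤ ad = bc + 1 forces b = c = 0 and then a = d = 1.
dominant⇒z : ∀ {a b c d} → c < a → b < d → Special (mat a b c d) → mat a b c d ≡ zM
dominant⇒z {a} {b} {c} {d} c<a b<d sp
  with m+n≡0⇒m≡0 b b+c≡0 | m+n≡0⇒n≡0 b b+c≡0
  where
  expand-product : ∀ b c → suc c * suc b ≡ b * c + 1 + (b + c)
  expand-product = solve-∀
  b+c≡0 : b + c ≡ 0
  b+c≡0 = m+n≤m⇒n≡0 (b * c + 1)
            (subst₂ _≤_ (expand-product b c) sp (*-mono-≤ c<a b<d))
... | refl | refl with m*n≡1⇒m≡1 a d sp | m*n≡1⇒n≡1 a d sp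
... | refl | refl = refl

-- Euclid's step: compare the rows of a special matrix entrywise.
origin : ∀ m → Special m → Origin m
origin (mat a b c d) sp with ≤-<-connex a c | ≤-<-connex d b
... | inj₁ a≤c | inj₁ d≤b =
  -- ad ≤ cb would contradict ad = bc + 1
  ⊥-elim (1+n≰n (subst₂ _≤_ (trans sp (+-comm (b * c) 1)) (*-comm c b) (*-mono-≤ a≤c d≤b)))
... | inj₁ a≤c | inj₂ b<d with m≤n⇒∃[o]m+o≡n a≤c | m≤n⇒∃[o]m+o≡n (<⇒≤ b<d)
...   | c′ , refl | d′ , refl =
  childOf left (mat a b c′ d′) (parent-special left (mat a b c′ d′) sp) refl
origin (mat a b c d) sp | inj₂ c<a | inj₁ d≤b with ≤⇒∃+ˡ (<⇒≤ c<a) | ≤⇒∃+ˡ d≤b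
...   | a′ , refl | b′ , refl =
  childOf right (mat a′ b′ c d) (parent-special right (mat a′ b′ c d) sp) refl
origin (mat a b c d) sp | inj₂ c<a | inj₂ b<d = root (dominant⇒z c<a b<d sp)

childIndex : ∀ ws → Side → Fin (length ws) → Fin (length (expand ws))
childIndex (w ∷ ws) s     (fsuc i) = fsuc (fsuc (childIndex ws s i))
childIndex (w ∷ ws) left  fzero    = fzero
childIndex (w ∷ ws) right fzero    = fsuc fzero

lookup-childIndex : ∀ ws s i → lookup (expand ws) (childIndex ws s i) ≡ child s (lookup ws i)
lookup-childIndex (w ∷ ws) s     (fsuc i) = lookup-childIndex ws s i
lookup-childIndex (w ∷ ws) left  fzero    = refl
lookup-childIndex (w ∷ ws) right fzero    = refl

data ExpandIndex (ws : List Mat) : Fin (length (expand ws)) → Set where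
  at : ∀ s i → ExpandIndex ws (childIndex ws s i)

expandIndex : ∀ ws j → ExpandIndex ws j
expandIndex (w ∷ ws) fzero           = at left fzero
expandIndex (w ∷ ws) (fsuc fzero)    = at right fzero
expandIndex (w ∷ ws) (fsuc (fsuc j)) with expandIndex ws j
... | at s i = at s (fsuc i)

row-special : ∀ n i → Special (lookup (row n) i)
row-special zero    fzero = refl
row-special (suc n) j with expandIndex (row n) j
... | at s i rewrite lookup-childIndex (row n) s i = child-special s _ (row-special n i)

-- Distinct positions carry distinct matrices: z is no child, and a child
-- determines its side and parent.
entry-injective : ∀ n n′ i i′ → lookup (row n) i ≡ lookup (row n′) i′ →
                  _≡_ {A = Position} (n , i) (n′ , i′)
entry-injective zero zero fzero fzero _ = refl
entry-injective zero (suc n′) fzero j′ eq with expandIndex (row n′) j′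
... | at s′ i′ = ⊥-elim (child≢z s′ _ (trans (sym (lookup-childIndex (row n′) s′ i′)) (sym eq)))
entry-injective (suc n) zero j fzero eq with expandIndex (row n) j
... | at s i = ⊥-elim (child≢z s _ (trans (sym (lookup-childIndex (row n) s i)) eq))
entry-injective (suc n) (suc n′) j j′ eq with expandIndex (row n) j | expandIndex (row n′) j′
... | at s i | at s′ i′
  with child-injective s s′ (row-special n i) (row-special n′ i′)
         (trans (sym (lookup-childIndex (row n) s i)) (trans eq (lookup-childIndex (row n′) s′ i′)))
... | refl , same-parent with entry-injective n n′ i i′ same-parent
... | refl = refl

vertex-special : ∀ {m} → IsVertexT m → Special m
vertex-special ((n , i) , refl) = row-special n i

vertex-child : ∀ s {m} → IsVertexT m → IsVertexT (child s m)
vertex-child s ((n , i) , refl) = (suc n , childIndex (row n) s i) , lookup-childIndex (row n) s i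

special⇒vertex : ∀ m → Special m → IsVertexT m
special⇒vertex = All.wfRec (On.wellFounded size <-wellFounded) 0ℓ (λ m → Special m → IsVertexT m) step
  where
  step : ∀ m → (∀ {p} → size p < size m → Special p → IsVertexT p) → Special m → IsVertexT m
  step m rec sp with origin m sp
  ... | root refl              = (zero , fzero) , refl
  ... | childOf s p sp-p refl = vertex-child s (rec (size-child s p sp-p) sp-p)

special⇒positive : ∀ m → Special m → PositiveLFT m
special⇒positive m sp det≡ = m+1+n≢m (b m * c m) (trans (sym sp) det≡)

child-edge : ∀ s {u} → IsVertexT u → Edge 𝒯 u (child s u)
child-edge left  vu = vu , inj₁ refl
child-edge right vu = vu , inj₂ refl

edge-child : ∀ {u v} → Edge 𝒯 u v → Σ Side λ s → v ≡ child s u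
edge-child (_ , inj₁ e) = left  , e
edge-child (_ , inj₂ e) = right , e

edge-head : ∀ {u v} → Edge 𝒯 u v → IsVertexT v
edge-head e@(vu , _) with edge-child e
... | s , refl = vertex-child s vu

same-tail : ∀ {u u′ v} → Edge 𝒯 u v → Edge 𝒯 u′ v → u ≡ u′
same-tail e@(vu , _) e′@(vu′ , _) with edge-child e | edge-child e′
... | s , refl | s′ , eq = proj₂ (child-injective s s′ (vertex-special vu) (vertex-special vu′) eq)

unique-parent : ∀ v → IsVertexT v → v ≢ zM → ∃! _≡_ (λ u → Edge 𝒯 u v)
unique-parent v vv v≢z with origin v (vertex-special vv)
... | root v≡z = ⊥-elim (v≢z v≡z)
... | childOf s p sp refl = p , e , same-tail e
  where
  e : Edge 𝒯 p (child s p)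
  e = child-edge s (special⇒vertex p sp)

module _ {ℓ} {V : Set ℓ} {G : DiGraph V} where

  _++ᵖ_ : ∀ {u v w} → UPath G u v → UPath G v w → UPath G u w
  stay _  ++ᵖ q = q
  fwd e p ++ᵖ q = fwd e (p ++ᵖ q)
  bwd e p ++ᵖ q = bwd e (p ++ᵖ q)

  reverse : (∀ {u v} → Edge G u v → Vertex G u) → (∀ {u v} → Edge G u v → Vertex G v) →
            ∀ {u v} → UPath G u v → UPath G v u
  reverse tail head (stay vu) = stay vu
  reverse tail head (fwd e p) = reverse tail head p ++ᵖ bwd e (stay (tail e))
  reverse tail head (bwd e p) = reverse tail head p ++ᵖ fwd e (stay (head e))

path-to-root : ∀ n i → UPath 𝒯 (lookup (row n) i) zM
path-to-root zero    fzero = stay ((zero , fzero) , refl)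
path-to-root (suc n) j with expandIndex (row n) j
... | at s i rewrite lookup-childIndex (row n) s i =
  bwd (child-edge s ((n , i) , refl)) (path-to-root n i)

connected : ∀ u v → IsVertexT u → IsVertexT v → UPath 𝒯 u v
connected u v ((n , i) , refl) ((n′ , i′) , refl) =
  path-to-root n i ++ᵖ reverse proj₁ edge-head (path-to-root n′ i′)

mainTheorem2 : IsRootedInfiniteBinaryTree 𝒯 zM
               × (∀ m → IsVertexT m ⇔ (PositiveLFT m × Special m))
               × (∀ m → PositiveLFT m → Special m → ∃! _≡_ (λ (p : Position) → entry p ≡ m))
mainTheorem2 =
  (two-children , (root-vertex , no-parent) , unique-parent , connected) ,
  (λ m → mk⇔ (λ vm → special⇒positive m (vertex-special vm) , vertex-special vm)
             (λ (_ , sp) → special⇒vertex m sp)) ,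
  (λ m _ sp → occurs-once (special⇒vertex m sp))
  where
  two-children : ∀ u → IsVertexT u →
    Σ Mat λ v₁ → Σ Mat λ v₂ → v₁ ≢ v₂ × Edge 𝒯 u v₁ × Edge 𝒯 u v₂ × (∀ v → Edge 𝒯 u v → v ≡ v₁ ⊎ v ≡ v₂)
  two-children u vu = leftChild u , rightChild u , left≢right (vertex-special vu) ,
                      child-edge left vu , child-edge right vu , λ _ → proj₂
  root-vertex : IsVertexT zM
  root-vertex = (zero , fzero) , refl
  no-parent : ∀ u → ¬ Edge 𝒯 u zM
  no-parent u e with edge-child e
  ... | s , z≡child = child≢z s u (sym z≡child)
  occurs-once : ∀ {m} → IsVertexT m → ∃! _≡_ (λ (p : Position) → entry p ≡ m)
  occurs-once ((n , i) , refl) = (n , i) , refl , λ { {n′ , i′} e → entry-injective n n′ i i′ (sym e) }
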